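{- Let $k\geq1$, let $G_i=(V_i,E_i)$ ($1\le i\le k$) and $H=(V_H,E_H)$ be pairwise vertex-disjoint, connected graphs, each with at least two vertices, let $u_i\in V_i$ and $v_1,\dots,v_k\in V_H$ (not necessarily distinct), let $J=G_{1,\ldots,k}\circ^{u_1,\dots,u_k}_{v_1,\dots,v_k}H$, and let $w\in V_H$. Then, for any choice of the sets $\mathrm{XVC}(\cdot,\cdot)$ involved, the set $$\mathrm{XVC}\bigl(\mathrm{SR}(H)\setminus\{v_1,\dots,v_k,w\},\ \mathrm{MD}_H(w)\setminus\{v_1,\dots,v_k,w\}\bigr)\cup\bigcup_{1\le i\le k}\mathrm{XVC}\bigl(\mathrm{SR}(G_i)\setminus\{u_i\},\ \mathrm{MD}_{G_i}(u_i)\bigr)$$ is a vertex cover of $\mathrm{SR}(J)\setminus\{w\}$ that contains all vertices of $\mathrm{MD}_J(w)$ and has minimum cardinality among all vertex covers of $\mathrm{SR}(J)\setminus\{w\}$ containing $\mathrm{MD}_J(w)$.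
   Context: All graphs are finite, undirected and simple. In a connected graph $G$, $d_G(x,y)$ is the distance and $N_G(x)$ the set of neighbours of $x$. A vertex $u$ is maximally distant from $w$ in $G$ if there is no $v\in N_G(u)$ with $d_G(v,w)>d_G(u,w)$; $\mathrm{MD}_G(u)$ is the set of vertices maximally distant from $u$ in $G$; two vertices are mutually maximally distant if each is maximally distant from the other. The strong resolving graph $\mathrm{SR}(G)$ has the vertex set of $G$, with an edge between distinct $u,v$ iff they are mutually maximally distant in $G$. For a graph $F$ and vertex set $X$, $F\setminus X$ denotes $F$ with the vertices of $X$ and their incident edges deleted. For a vertex set $M$ of $F$, $\mathrm{XVC}(F,M)$ denotes a vertex cover of $F$ that contains $M$ and has minimum cardinality among all vertex covers of $F$ containing $M$. The composed graph $J=G_{1,\ldots,k}\circ^{u_1,\dots,u_k}_{v_1,\dots,v_k}H$ has vertex set $(V_1\cup\dots\cup V_k\cup V_H)\setminus\{u_1,\dots,u_k\}$ and edge set $(E_1\cup\dots\cup E_k\cup E_H\cup\{\{x,v_i\}: x\in N_{G_i}(u_i),1\le i\le k\})\setminus\{\{x,u_i\}: x\in N_{G_i}(u_i),1\le i\le k\}$; i.e. $J$ is obtained by identifying each $u_i$ with $v_i$. -}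

module Defs where

open import Level using (0ℓ)
open import Data.Nat using (ℕ; zero; suc; _≤_)
open import Data.Fin using (Fin)
open import Data.Bool using (Bool; T)
open import Data.Product using (Σ; Σ-syntax; ∃; ∃₂; _×_; _,_)
open import Data.Sum using (_⊎_; inj₁; inj₂)
open import Data.Empty using (⊥)
open import Relation.Nullary using (¬_)
open import Relation.Binary.PropositionalEquality using (_≡_; _≢_)
open import Relation.Unary using (Pred)
open import Function.Bundles using (_↔_)
open import Data.Refinement using (Refinement; value)

record Graph : Set₁ where
  field
    V   : Set
    adj : V → V → Set
open Graph public

Finite : Graph → Set
Finite G = ∃ λ n → V G ↔ Fin n

Simple : Graph → Set
Simple G = (∀ x y → adj G x y → adj G y x) × (∀ x → ¬ adj G x x)

AtLeastTwo : Graph → Set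
AtLeastTwo G = ∃₂ λ (x y : V G) → x ≢ y

data Walk (G : Graph) : V G → V G → ℕ → Set where
  here : ∀ {x} → Walk G x x zero
  step : ∀ {x y z n} → adj G x z → Walk G z y n → Walk G x y (suc n)

Connected : Graph → Set
Connected G = ∀ x y → ∃ λ n → Walk G x y n

Dist : (G : Graph) → V G → V G → ℕ → Set
Dist G x y d = Walk G x y d × (∀ m → Walk G x y m → d ≤ m)

MaxDist : (G : Graph) → V G → V G → Set
MaxDist G u w = ∀ v → adj G u v → ∀ dv du → Dist G v w dv → Dist G u w du → dv ≤ du

MD : (G : Graph) → V G → Pred (V G) 0ℓ
MD G u x = MaxDist G x u

SR : Graph → Graph
SR G = record { V = V G ; adj = λ u v → (u ≢ v) × MaxDist G u v × MaxDist G v u }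

VSet : Graph → Set
VSet G = V G → Bool

Card : (G : Graph) → VSet G → ℕ → Set
Card G C n = (Σ (V G) λ x → T (C x)) ↔ Fin n

IsVC : (F : Graph) → Pred (V F) 0ℓ → VSet F → Set
IsVC F X C =
  (∀ x → T (C x) → ¬ X x) ×
  (∀ x y → adj F x y → ¬ X x → ¬ X y → T (C x) ⊎ T (C y))

IsXVC : (F : Graph) → Pred (V F) 0ℓ → Pred (V F) 0ℓ → VSet F → Set
IsXVC F X M C =
  IsVC F X C ×
  (∀ x → M x → T (C x)) ×
  (∀ (C' : VSet F) → IsVC F X C' → (∀ x → M x → T (C' x)) →
     ∀ n n' → Card F C n → Card F C' n' → n ≤ n')

module Compose {k : ℕ} (G : Fin k → Graph) (H : Graph)
               (u : (i : Fin k) → V (G i)) (v : Fin k → V H) where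

  Rest : Fin k → Set
  Rest i = Refinement (V (G i)) (λ x → x ≢ u i)

  VJ : Set
  VJ = (Σ[ i ∈ Fin k ] Rest i) ⊎ V H

  data AdjJ : VJ → VJ → Set where
    inG   : ∀ i (x y : Rest i) → adj (G i) (value x) (value y) →
            AdjJ (inj₁ (i , x)) (inj₁ (i , y))
    inH   : ∀ a b → adj H a b → AdjJ (inj₂ a) (inj₂ b)
    glueˡ : ∀ i (x : Rest i) → adj (G i) (value x) (u i) →
            AdjJ (inj₁ (i , x)) (inj₂ (v i))
    glueʳ : ∀ i (x : Rest i) → adj (G i) (value x) (u i) →
            AdjJ (inj₂ (v i)) (inj₁ (i , x))

  J : Graph
  J = record { V = VJ ; adj = AdjJ }

  union : VSet H → ((i : Fin k) → VSet (G i)) → VSet J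
  union CH CG (inj₁ (i , x)) = CG i (value x)
  union CH CG (inj₂ y)       = CH y

{-# OPTIONS --safe #-}
module Submission where

-- Every walk from the pendant copy of G_i − u_i to the rest of J passes through v_i, so
-- distances from a pendant vertex x to a vertex t outside its pendant split as
-- d_{G_i}(x, u_i) + d_J(v_i, t), while distances inside a pendant, or inside H, are those
-- of G_i, resp. H.  Hence a pendant vertex is maximally distant from an outside vertex iff it
-- is maximally distant from u_i in G_i, and v_i is maximally distant from no outside vertex
-- (its pendant neighbour is farther away).  So each edge of SR(J) − w either lies in one
-- pendant and is an edge of SR(G_i), or lies in H avoiding all v_i and w and is an edge of
-- SR(H), or has an endpoint in MD_{G_i}(u_i); and MD_J(w) is the union of the MD_{G_i}(u_i)
-- and of MD_H(w) minus the v_i and w.  The union is therefore a cover containing MD_J(w).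
-- Conversely a competing cover restricts, on H and on each pendant, to covers containing the
-- corresponding MD sets, each at least as large as the given minimum ones; as these pieces
-- are disjoint, they inject the union into the competitor.

open import Defs
open import Data.Nat using (ℕ; zero; suc; _≤_; _<_; _+_; z≤n; s≤s; _≤?_)
open import Data.Nat.Properties
  using (≤-refl; ≤-trans; ≤-antisym; +-mono-≤; +-cancelʳ-≤; ≤-<-trans; n≮n; m≤n+m; m≤n⇒m≤1+n;
         n≤0⇒n≡0; ≮⇒≥)
open import Data.Nat.Induction using (<-rec)
open import Data.Fin using (Fin)
import Data.Fin as F
open import Data.Fin.Properties using (injective⇒≤; inject≤-injective; +↔⊎; 1↔⊤; any?)
open import Data.Bool using (Bool; true; false; T; if_then_else_)
open import Data.Bool.Properties using (T-irrelevant)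
open import Data.Product using (Σ; ∃; ∃₂; _×_; _,_; proj₁; proj₂)
import Data.Product as Product
open import Data.Product.Function.Dependent.Propositional using (Σ-↣; Σ-↔)
open import Data.Sum using (_⊎_; inj₁; inj₂)
import Data.Sum as Sum
open import Data.Sum.Function.Propositional using (_⊎-↣_; _⊎-↔_)
open import Data.Empty using (⊥; ⊥-elim)
import Data.Empty.Irrelevant as Irrelevant
open import Data.Unit using (⊤; tt)
open import Data.Refinement using (Refinement; value; _,_; value-injective)
open import Data.Irrelevant using ([_])
open import Function using (_∘_; id)
open import Function.Bundles using (_↔_; _↣_; Inverse; Injection; mk↔ₛ′; mk↣)
open import Function.Construct.Composition using (_↔-∘_; _↣-∘_)
open import Function.Construct.Identity using (↔-id)
open import Function.Properties.Inverse using (↔-sym; ↔⇒↣)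
open import Function.Related.TypeIsomorphisms using (Σ-assoc; Σ-distribʳ-⊎)
open import Relation.Nullary using (¬_; yes; no; does)
open import Relation.Nullary.Decidable using (decidable-stable; map′; _⊎-dec_)
open import Relation.Unary using (Decidable)
open import Relation.Binary.Definitions using (DecidableEquality)
open import Relation.Binary.PropositionalEquality
  using (_≡_; _≢_; refl; sym; trans; cong; subst; subst₂; ≡-≟-identity)

-- Adjacency need not be decidable, so distances exist only up to double negation; they are
-- only ever used to establish inequalities between naturals, which are ¬¬-stable.
¬¬-least : (P : ℕ → Set) → ∀ {n} → P n → ¬ ¬ ∃ λ m → P m × (∀ k → P k → m ≤ k)
¬¬-least P {n} pn no-least = <-rec (λ m → ¬ P m) none-below n pn
  where
  none-below : ∀ m → (∀ {j} → j < m → ¬ P j) → ¬ P m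
  none-below m below pm = no-least (m , pm , λ j pj → ≮⇒≥ λ j<m → below j<m pj)

module _ {G : Graph} where

  _++ʷ_ : ∀ {x y z m n} → Walk G x y m → Walk G y z n → Walk G x z (m + n)
  here       ++ʷ q = q
  step x~z p ++ʷ q = step x~z (p ++ʷ q)

  Walk-zero⇒≡ : ∀ {x y} → Walk G x y 0 → x ≡ y
  Walk-zero⇒≡ here = refl

  Dist-unique : ∀ {x y d d′} → Dist G x y d → Dist G x y d′ → d ≡ d′
  Dist-unique (p , p-min) (q , q-min) = ≤-antisym (p-min _ q) (q-min _ p)

  Dist-refl : ∀ {x} → Dist G x x 0
  Dist-refl = here , λ _ _ → z≤n

  Walk⇒¬¬Dist : ∀ {x y n} → Walk G x y n → ¬ ¬ ∃ (Dist G x y)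
  Walk⇒¬¬Dist = ¬¬-least (Walk G _ _)

  ¬MaxDist-self : Simple G → ∀ {x z} → adj G x z → ¬ MaxDist G x x
  ¬MaxDist-self (symmetric , irreflexive) {x} {z} x~z x-md =
    Walk⇒¬¬Dist (step (symmetric _ _ x~z) here) λ (d , z⇝x) → z≢x d z⇝x
    where
    z≢x : ∀ d → Dist G z x d → ⊥
    z≢x d z⇝x with n≤0⇒n≡0 (x-md z x~z d 0 z⇝x Dist-refl)
    ... | refl = irreflexive x (subst (adj G x) (Walk-zero⇒≡ (proj₁ z⇝x)) x~z)

  neighbour-towards : Connected G → ∀ x {y} → y ≢ x → ∃ (adj G x)
  neighbour-towards connected x {y} y≢x with connected x y
  ... | zero  , here       = ⊥-elim (y≢x refl)
  ... | suc _ , step x~z _ = _ , x~z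

  has-neighbour : DecidableEquality (V G) → Connected G → AtLeastTwo G → ∀ x → ∃ (adj G x)
  has-neighbour _≟_ connected (p , q , p≢q) x with p ≟ x
  ... | yes refl = neighbour-towards connected x (p≢q ∘ sym)
  ... | no p≢x   = neighbour-towards connected x p≢x

-- π may contract edges, so it never lengthens walks; hence ι preserves distances.
module Retraction (A B : Graph) (ι : V B → V A) (π : V A → V B)
  (ι-adj : ∀ {x y} → adj B x y → adj A (ι x) (ι y))
  (π-adj : ∀ {x y} → adj A x y → π x ≡ π y ⊎ adj B (π x) (π y))
  (π∘ι : ∀ x → π (ι x) ≡ x) where

  ι-injective : ∀ {x y} → ι x ≡ ι y → x ≡ y
  ι-injective {x} {y} eq = trans (sym (π∘ι x)) (trans (cong π eq) (π∘ι y))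

  Walk-embed : ∀ {x y n} → Walk B x y n → Walk A (ι x) (ι y) n
  Walk-embed here         = here
  Walk-embed (step x~z p) = step (ι-adj x~z) (Walk-embed p)

  Walk-retract : ∀ {x y n} → Walk A x y n → ∃ λ m → m ≤ n × Walk B (π x) (π y) m
  Walk-retract here = 0 , z≤n , here
  Walk-retract {y = y} (step x~z p) with Walk-retract p | π-adj x~z
  ... | m , m≤n , q | inj₁ πx≡πz = m , m≤n⇒m≤1+n m≤n , subst (λ s → Walk B s (π y) m) (sym πx≡πz) q
  ... | m , m≤n , q | inj₂ πx~πz = suc m , s≤s m≤n , step πx~πz q

  Walk-reflect : ∀ {x y n} → Walk A (ι x) (ι y) n → ∃ λ m → m ≤ n × Walk B x y m
  Walk-reflect {x} {y} p with Walk-retract p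
  ... | m , m≤n , q = m , m≤n , subst₂ (λ s t → Walk B s t m) (π∘ι x) (π∘ι y) q

  Dist-embed : ∀ {x y d} → Dist B x y d → Dist A (ι x) (ι y) d
  Dist-embed (p , p-min) =
    Walk-embed p , λ m q → let (m′ , m′≤m , q′) = Walk-reflect q in ≤-trans (p-min m′ q′) m′≤m

  Dist-reflect : ∀ {x y d} → Dist A (ι x) (ι y) d → Dist B x y d
  Dist-reflect {x} {y} (p , p-min) with Walk-reflect p
  ... | m , m≤d , q =
    subst (Walk B x y) (≤-antisym m≤d (p-min m (Walk-embed q))) q , λ m′ q′ → p-min m′ (Walk-embed q′)

  MaxDist-reflect : ∀ {a b} → MaxDist A (ι a) (ι b) → MaxDist B a b
  MaxDist-reflect md c a~c dc da c⇝b a⇝b = md (ι c) (ι-adj a~c) dc da (Dist-embed c⇝b) (Dist-embed a⇝b)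

  MaxDist-embed : ∀ {a b} → (∀ {t} → adj A (ι a) t → ∃ λ c → adj B a c × t ≡ ι c) →
                  MaxDist B a b → MaxDist A (ι a) (ι b)
  MaxDist-embed neighbours md t a~t dt da t⇝b a⇝b with neighbours a~t
  ... | c , a~c , refl = md c a~c dt da (Dist-reflect t⇝b) (Dist-reflect a⇝b)

Finite⇒DecEq : ∀ {G} → Finite G → DecidableEquality (V G)
Finite⇒DecEq (_ , V↔Fin) x y =
  map′ (Injection.injective (↔⇒↣ V↔Fin)) (cong (Inverse.to V↔Fin))
       (Inverse.to V↔Fin x F.≟ Inverse.to V↔Fin y)

count : ∀ {n} → (Fin n → Bool) → ℕ
count {zero}  P = 0
count {suc n} P = if P F.zero then suc (count (P ∘ F.suc)) else count (P ∘ F.suc)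

Σ-Fin-suc↔ : ∀ {n} (P : Fin (suc n) → Bool) →
             Σ (Fin (suc n)) (T ∘ P) ↔ (T (P F.zero) ⊎ Σ (Fin n) (T ∘ P ∘ F.suc))
Σ-Fin-suc↔ P = mk↔ₛ′ to Sum.[ F.zero ,_ , Product.map F.suc id ]
  (λ { (inj₁ _) → refl ; (inj₂ _) → refl }) (λ { (F.zero , _) → refl ; (F.suc _ , _) → refl })
  where
  to : Σ (Fin _) (T ∘ P) → T (P F.zero) ⊎ Σ (Fin _) (T ∘ P ∘ F.suc)
  to (F.zero  , p) = inj₁ p
  to (F.suc i , p) = inj₂ (i , p)

T⊎Fin↔Fin : ∀ b {m} → (T b ⊎ Fin m) ↔ Fin (if b then suc m else m)
T⊎Fin↔Fin true  = ↔-sym (+↔⊎ {1}) ↔-∘ (↔-sym 1↔⊤ ⊎-↔ ↔-id _)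
T⊎Fin↔Fin false = mk↔ₛ′ Sum.[ (λ ()) , id ] inj₂ (λ _ → refl) Sum.[ (λ ()) , (λ _ → refl) ]

count-↔ : ∀ {n} (P : Fin n → Bool) → Σ (Fin n) (T ∘ P) ↔ Fin (count P)
count-↔ {zero}  P = mk↔ₛ′ (λ ()) (λ ()) (λ ()) (λ ())
count-↔ {suc n} P = T⊎Fin↔Fin (P F.zero) ↔-∘ ((↔-id _ ⊎-↔ count-↔ (P ∘ F.suc)) ↔-∘ Σ-Fin-suc↔ P)

Card-exists : ∀ {G} → Finite G → (C : VSet G) → ∃ (Card G C)
Card-exists (_ , V↔Fin) C =
  _ , count-↔ (C ∘ Inverse.from V↔Fin) ↔-∘ ↔-sym (Σ-↔ (↔-sym V↔Fin) (↔-id _))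

↣⇒≤ : ∀ {A B : Set} {m n} → A ↣ B → A ↔ Fin m → B ↔ Fin n → m ≤ n
↣⇒≤ A↣B A↔m B↔n =
  injective⇒≤ (Injection.injective (↔⇒↣ B↔n ↣-∘ (A↣B ↣-∘ ↔⇒↣ (↔-sym A↔m))))

≤⇒↣ : ∀ {A B : Set} {m n} → A ↔ Fin m → B ↔ Fin n → m ≤ n → A ↣ B
≤⇒↣ A↔m B↔n m≤n =
  ↔⇒↣ (↔-sym B↔n) ↣-∘ (mk↣ (inject≤-injective m≤n m≤n _ _) ↣-∘ ↔⇒↣ A↔m)

Σ-T-≡ : ∀ {A : Set} {C : A → Bool} {x y} {p : T (C x)} {q : T (C y)} →
        x ≡ y → _≡_ {A = Σ A (T ∘ C)} (x , p) (y , q)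
Σ-T-≡ refl = cong (_ ,_) (T-irrelevant _ _)

T-↣ : ∀ {a b} → (T a → T b) → T a ↣ T b
T-↣ f = mk↣ {to = f} λ _ → T-irrelevant _ _

value-↣ : ∀ {A : Set} {P : A → Set} (C : A → Bool) → Σ (Refinement A P) (T ∘ C ∘ value) ↣ Σ A (T ∘ C)
value-↣ C = mk↣ {to = Product.map value id} λ eq → Σ-T-≡ (value-injective (cong proj₁ eq))

_∖_ : ∀ {A : Set} {X : A → Set} → (A → Bool) → Decidable X → A → Bool
(C ∖ X?) x = if does (X? x) then false else C x

module _ {A : Set} {X : A → Set} (C : A → Bool) (X? : Decidable X) where

  T-∖⁺ : ∀ {x} → ¬ X x → T (C x) → T ((C ∖ X?) x)
  T-∖⁺ {x} x∉X x∈C with X? x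
  ... | yes x∈X = x∉X x∈X
  ... | no _    = x∈C

  T-∖⁻ : ∀ {x} → T ((C ∖ X?) x) → ¬ X x × T (C x)
  T-∖⁻ {x} x∈ with X? x
  ... | no x∉X = x∉X , x∈

  ∖-↣ : Σ A (T ∘ (C ∖ X?)) ↣ Σ A (T ∘ C)
  ∖-↣ = Σ-↣ (↔-id _) (T-↣ (proj₂ ∘ T-∖⁻))

IsVC-pullback : ∀ {A B : Graph} {X : V A → Set} {Y : V B → Set} (X? : Decidable X) (f : V A → V B) →
  (∀ {x y} → ¬ X x → ¬ X y → adj A x y → adj B (f x) (f y)) → (∀ {x} → ¬ X x → ¬ Y (f x)) →
  ∀ {C} → IsVC B Y C → IsVC A X ((C ∘ f) ∖ X?)
IsVC-pullback X? f f-adj f-avoids {C} (_ , covers) =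
  (λ _ x∈ → proj₁ (T-∖⁻ (C ∘ f) X? x∈)) ,
  λ x y x~y x∉X y∉X → Sum.map (T-∖⁺ (C ∘ f) X? x∉X) (T-∖⁺ (C ∘ f) X? y∉X)
    (covers (f x) (f y) (f-adj x∉X y∉X x~y) (f-avoids x∉X) (f-avoids y∉X))

IsXVC⇒↣ : ∀ {F X M C C′} → Finite F → IsXVC F X M C → IsVC F X C′ → (∀ x → M x → T (C′ x)) →
          Σ (V F) (T ∘ C) ↣ Σ (V F) (T ∘ C′)
IsXVC⇒↣ {F} {C = C} {C′} finite (_ , _ , minimal) C′-IsVC M⊆C′
  with Card-exists {F} finite C | Card-exists {F} finite C′
... | n , C↔n | n′ , C′↔n′ = ≤⇒↣ C↔n C′↔n′ (minimal _ C′-IsVC M⊆C′ n n′ C↔n C′↔n′)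

module Composition {k : ℕ} (G : Fin k → Graph) (H : Graph)
  (hG : ∀ i → Finite (G i) × Simple (G i) × Connected (G i) × AtLeastTwo (G i))
  (finiteH : Finite H) (simpleH : Simple H) (connectedH : Connected H) (nontrivialH : AtLeastTwo H)
  (u : (i : Fin k) → V (G i)) (v : Fin k → V H) where

  open Compose G H u v

  finiteG : ∀ i → Finite (G i)
  finiteG i = proj₁ (hG i)

  simpleG : ∀ i → Simple (G i)
  simpleG i = proj₁ (proj₂ (hG i))

  symG : ∀ i {x y} → adj (G i) x y → adj (G i) y x
  symG i = proj₁ (simpleG i) _ _

  irreflG : ∀ i x → ¬ adj (G i) x x
  irreflG i = proj₂ (simpleG i)

  connectedG : ∀ i → Connected (G i)
  connectedG i = proj₁ (proj₂ (proj₂ (hG i)))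

  nontrivialG : ∀ i → AtLeastTwo (G i)
  nontrivialG i = proj₂ (proj₂ (proj₂ (hG i)))

  decG : ∀ i → DecidableEquality (V (G i))
  decG i = Finite⇒DecEq {G i} (finiteG i)

  decH : DecidableEquality (V H)
  decH = Finite⇒DecEq {H} finiteH

  embed : (i : Fin k) → V (G i) → VJ
  embed i x with decG i x (u i)
  ... | yes _   = inj₂ (v i)
  ... | no x≢u  = inj₁ (i , (x , [ x≢u ]))

  embed-rest : ∀ i (a : Rest i) → embed i (value a) ≡ inj₁ (i , a)
  embed-rest i (x , [ x≢u ]) with decG i x (u i)
  ... | yes x≡u = Irrelevant.⊥-elim (x≢u x≡u)
  ... | no _    = refl

  embed-u : ∀ i → embed i (u i) ≡ inj₂ (v i)
  embed-u i with decG i (u i) (u i)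
  ... | yes _  = refl
  ... | no u≢u = ⊥-elim (u≢u refl)

  embed-adj : ∀ i {x y} → adj (G i) x y → AdjJ (embed i x) (embed i y)
  embed-adj i {x} {y} x~y with decG i x (u i) | decG i y (u i)
  ... | yes refl | yes refl = ⊥-elim (irreflG i _ x~y)
  ... | yes refl | no y≢u   = glueʳ i (y , [ y≢u ]) (symG i x~y)
  ... | no x≢u   | yes refl = glueˡ i (x , [ x≢u ]) x~y
  ... | no _     | no _     = inG i _ _ x~y

  retract : (i : Fin k) → VJ → V (G i)
  retract i (inj₁ (j , a)) with j F.≟ i
  ... | yes refl = value a
  ... | no _     = u i
  retract i (inj₂ _) = u i

  retract-rest : ∀ i (a : Rest i) → retract i (inj₁ (i , a)) ≡ value a
  retract-rest i a rewrite ≡-≟-identity F._≟_ (refl {x = i}) = refl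

  retract-embed : ∀ i x → retract i (embed i x) ≡ x
  retract-embed i x with decG i x (u i)
  ... | yes x≡u = sym x≡u
  ... | no x≢u  = retract-rest i (x , [ x≢u ])

  retract-adj : ∀ i {x y} → AdjJ x y → retract i x ≡ retract i y ⊎ adj (G i) (retract i x) (retract i y)
  retract-adj i (inG j _ _ x~y) with j F.≟ i
  ... | yes refl = inj₂ x~y
  ... | no _     = inj₁ refl
  retract-adj i (inH _ _ _) = inj₁ refl
  retract-adj i (glueˡ j _ x~u) with j F.≟ i
  ... | yes refl = inj₂ x~u
  ... | no _     = inj₁ refl
  retract-adj i (glueʳ j _ x~u) with j F.≟ i
  ... | yes refl = inj₂ (symG i x~u)
  ... | no _     = inj₁ refl

  module Pendant (i : Fin k) = Retraction J (G i) (embed i) (retract i) (embed-adj i) (retract-adj i) (retract-embed i)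

  project : VJ → V H
  project (inj₁ (j , _)) = v j
  project (inj₂ x)       = x

  project-adj : ∀ {x y} → AdjJ x y → project x ≡ project y ⊎ adj H (project x) (project y)
  project-adj (inG _ _ _ _)  = inj₁ refl
  project-adj (inH _ _ x~y)  = inj₂ x~y
  project-adj (glueˡ _ _ _)  = inj₁ refl
  project-adj (glueʳ _ _ _)  = inj₁ refl

  module Host = Retraction J H inj₂ project (inH _ _) project-adj (λ _ → refl)

  Simple-J : Simple J
  Simple-J = symmetric , irreflexive
    where
    symmetric : ∀ x y → AdjJ x y → AdjJ y x
    symmetric _ _ (inG i a b a~b)  = inG i b a (symG i a~b)
    symmetric _ _ (inH x y x~y)    = inH y x (proj₁ simpleH _ _ x~y)
    symmetric _ _ (glueˡ i a a~u)  = glueʳ i a a~u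
    symmetric _ _ (glueʳ i a a~u)  = glueˡ i a a~u

    irreflexive : ∀ x → ¬ AdjJ x x
    irreflexive _ (inG i a _ a~a) = irreflG i (value a) a~a
    irreflexive _ (inH x _ x~x)   = proj₂ simpleH x x~x

  Rest≢u : ∀ {i} (a : Rest i) → value a ≢ u i
  Rest≢u (_ , [ a≢u ]) a≡u = Irrelevant.⊥-elim (a≢u a≡u)

  pendant-neighbours : ∀ i (a : Rest i) {t} → AdjJ (inj₁ (i , a)) t →
                       ∃ λ c → adj (G i) (value a) c × t ≡ embed i c
  pendant-neighbours i a (inG _ _ b a~b) = value b , a~b , sym (embed-rest i b)
  pendant-neighbours i a (glueˡ _ _ a~u) = u i , a~u , sym (embed-u i)

  host-neighbours : ∀ {x} → (∀ i → x ≢ v i) → ∀ {t} → AdjJ (inj₂ x) t →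
                    ∃ λ y → adj H x y × t ≡ inj₂ y
  host-neighbours _   (inH _ y x~y)  = y , x~y , refl
  host-neighbours x≢v (glueʳ i _ _)  = ⊥-elim (x≢v i refl)

  to-host : ∀ x → ∃ λ n → Walk J x (inj₂ (project x)) n
  to-host (inj₁ (j , a)) =
    _ , subst₂ (λ s t → Walk J s t _) (embed-rest j a) (embed-u j) (Pendant.Walk-embed j (proj₂ (connectedG j _ _)))
  to-host (inj₂ _) = 0 , here

  from-host : ∀ x → ∃ λ n → Walk J (inj₂ (project x)) x n
  from-host (inj₁ (j , a)) =
    _ , subst₂ (λ s t → Walk J s t _) (embed-u j) (embed-rest j a) (Pendant.Walk-embed j (proj₂ (connectedG j _ _)))
  from-host (inj₂ _) = 0 , here

  Connected-J : Connected J
  Connected-J x y =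
    _ , proj₂ (to-host x) ++ʷ (Host.Walk-embed (proj₂ (connectedH _ _)) ++ʷ proj₂ (from-host y))

  ¬¬Dist-J : ∀ x y → ¬ ¬ ∃ (Dist J x y)
  ¬¬Dist-J x y = Walk⇒¬¬Dist (proj₂ (Connected-J x y))

  ¬¬Dist-G : ∀ i x y → ¬ ¬ ∃ (Dist (G i) x y)
  ¬¬Dist-G i x y = Walk⇒¬¬Dist (proj₂ (connectedG i x y))

  Outside : Fin k → VJ → Set
  Outside i (inj₁ (j , _)) = j ≢ i
  Outside i (inj₂ _)       = ⊤

  exit-split : ∀ {i a t m} → Outside i t → Walk J (inj₁ (i , a)) t m →
               ∃₂ λ m₁ m₂ → Walk (G i) (value a) (u i) m₁ × Walk J (inj₂ (v i)) t m₂ × m₁ + m₂ ≡ m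
  exit-split out here = ⊥-elim (out refl)
  exit-split out (step (inG _ _ _ a~b) p) with exit-split out p
  ... | m₁ , m₂ , p₁ , p₂ , refl = suc m₁ , m₂ , step a~b p₁ , p₂ , refl
  exit-split out (step (glueˡ _ _ a~u) p) = 1 , _ , step a~u here , p , refl

  glue-shortcut : ∀ {i a t m} → Outside i t → Walk J (inj₁ (i , a)) t m →
                  ∃ λ m′ → m′ < m × Walk J (inj₂ (v i)) t m′
  glue-shortcut {a = a} out p with exit-split out p
  ... | zero   , _  , p₁ , _  , _    = ⊥-elim (Rest≢u a (Walk-zero⇒≡ p₁))
  ... | suc m₁ , m₂ , _  , p₂ , refl = m₂ , s≤s (m≤n+m m₂ m₁) , p₂

  Dist-via-glue : ∀ {i c t d D} → Outside i t → Dist (G i) c (u i) d → Dist J (inj₂ (v i)) t D →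
                  Dist J (embed i c) t (d + D)
  Dist-via-glue {i} {c} {t} {d} {D} out (p , p-min) (q , q-min) =
    subst (λ s → Walk J (embed i c) s d) (embed-u i) (Pendant.Walk-embed i p) ++ʷ q , shortest
    where
    shortest : ∀ m → Walk J (embed i c) t m → d + D ≤ m
    shortest m r with decG i c (u i)
    ... | yes refl = subst (λ d′ → d′ + D ≤ m) (sym (Dist-unique (p , p-min) Dist-refl)) (q-min m r)
    ... | no _ with exit-split out r
    ...   | m₁ , m₂ , r₁ , r₂ , refl = +-mono-≤ (p-min m₁ r₁) (q-min m₂ r₂)

  Dist-via-glue-rest : ∀ {i} (a : Rest i) {t d D} → Outside i t → Dist (G i) (value a) (u i) d →
                       Dist J (inj₂ (v i)) t D → Dist J (inj₁ (i , a)) t (d + D)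
  Dist-via-glue-rest {i} a {t} {d} {D} out a⇝u v⇝t =
    subst (λ s → Dist J s t (d + D)) (embed-rest i a) (Dist-via-glue out a⇝u v⇝t)

  MaxDist-outward⁻ : ∀ {i} (a : Rest i) {t} → Outside i t → MaxDist J (inj₁ (i , a)) t →
                     MaxDist (G i) (value a) (u i)
  MaxDist-outward⁻ {i} a {t} out a-md c a~c dc da c⇝u a⇝u = decidable-stable (dc ≤? da) λ dc≰da →
    ¬¬Dist-J (inj₂ (v i)) t λ (D , v⇝t) → dc≰da (+-cancelʳ-≤ D dc da
      (a-md (embed i c) (subst (λ s → AdjJ s (embed i c)) (embed-rest i a) (embed-adj i a~c)) (dc + D) (da + D)
            (Dist-via-glue out c⇝u v⇝t) (Dist-via-glue-rest a out a⇝u v⇝t)))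

  MaxDist-outward⁺ : ∀ {i} (a : Rest i) {t} → Outside i t → MaxDist (G i) (value a) (u i) →
                     MaxDist J (inj₁ (i , a)) t
  MaxDist-outward⁺ {i} a {t} out a-md s a~s ds da s⇝t a⇝t with pendant-neighbours i a a~s
  ... | c , a~c , refl = decidable-stable (ds ≤? da) λ ds≰da →
    ¬¬Dist-J (inj₂ (v i)) t λ (D , v⇝t) →
    ¬¬Dist-G i c (u i) λ (dc , c⇝u) →
    ¬¬Dist-G i (value a) (u i) λ (da′ , a⇝u) →
      ds≰da (subst₂ _≤_ (Dist-unique (Dist-via-glue out c⇝u v⇝t) s⇝t)
                         (Dist-unique (Dist-via-glue-rest a out a⇝u v⇝t) a⇝t)
                         (+-mono-≤ (a-md c a~c dc da′ c⇝u a⇝u) ≤-refl))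

  MaxDist-inside⁻ : ∀ {i} (a b : Rest i) → MaxDist J (inj₁ (i , a)) (inj₁ (i , b)) →
                    MaxDist (G i) (value a) (value b)
  MaxDist-inside⁻ {i} a b md =
    Pendant.MaxDist-reflect i (subst₂ (MaxDist J) (sym (embed-rest i a)) (sym (embed-rest i b)) md)

  MaxDist-inside⁺ : ∀ i {x y} → x ≢ u i → MaxDist (G i) x y → MaxDist J (embed i x) (embed i y)
  MaxDist-inside⁺ i {x} x≢u = Pendant.MaxDist-embed i λ x~t →
    pendant-neighbours i (x , [ x≢u ]) (subst (λ s → AdjJ s _) (embed-rest i (x , [ x≢u ])) x~t)

  MaxDist-host⁺ : ∀ {x y} → (∀ i → x ≢ v i) → MaxDist H x y → MaxDist J (inj₂ x) (inj₂ y)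
  MaxDist-host⁺ x≢v = Host.MaxDist-embed (host-neighbours x≢v)

  glue-neighbour : ∀ i → ∃ λ (a : Rest i) → adj (G i) (value a) (u i)
  glue-neighbour i with has-neighbour (decG i) (connectedG i) (nontrivialG i) (u i)
  ... | z , u~z = (z , [ z≢u ]) , symG i u~z
    where
    z≢u : z ≢ u i
    z≢u refl = irreflG i _ u~z

  ¬MaxDist-glue : ∀ i {t} → Outside i t → ¬ MaxDist J (inj₂ (v i)) t
  ¬MaxDist-glue i {t} out v-md with glue-neighbour i
  ... | a , a~u =
    ¬¬Dist-J (inj₁ (i , a)) t λ (D₁ , a⇝t) → ¬¬Dist-J (inj₂ (v i)) t λ (D₀ , v⇝t) →
      let (m , m<D₁ , q) = glue-shortcut out (proj₁ a⇝t) in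
      n≮n D₁ (≤-<-trans (≤-trans (v-md _ (glueʳ i a a~u) D₁ D₀ a⇝t v⇝t) (proj₂ v⇝t m q)) m<D₁)

  ¬MaxDist-u : ∀ i → ¬ MaxDist (G i) (u i) (u i)
  ¬MaxDist-u i = ¬MaxDist-self (simpleG i) (symG i (proj₂ (glue-neighbour i)))

  module Cover (w : V H) where

    Excluded : V H → Set
    Excluded x = (∃ λ i → x ≡ v i) ⊎ x ≡ w

    Excluded? : Decidable Excluded
    Excluded? x = any? (λ i → decH x (v i)) ⊎-dec decH x w

    ¬Excluded⇒≢v : ∀ {x} → ¬ Excluded x → ∀ i → x ≢ v i
    ¬Excluded⇒≢v x∉ i x≡v = x∉ (inj₁ (i , x≡v))

    ¬MaxDist-root : ¬ MaxDist J (inj₂ w) (inj₂ w)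
    ¬MaxDist-root = ¬MaxDist-self Simple-J (inH _ _ (proj₂ (has-neighbour decH connectedH nontrivialH w)))

    host-¬Excluded : ∀ {x y} → MaxDist J (inj₂ x) (inj₂ y) → _≢_ {A = VJ} (inj₂ x) (inj₂ w) →
                     ¬ Excluded x
    host-¬Excluded md _   (inj₁ (i , refl)) = ¬MaxDist-glue i tt md
    host-¬Excluded _  x≢w (inj₂ refl)       = x≢w refl

    module _ (CH : VSet H) (CG : (i : Fin k) → VSet (G i))
      (xvcH : IsXVC (SR H) Excluded (λ x → MD H w x × ¬ Excluded x) CH)
      (xvcG : ∀ i → IsXVC (SR (G i)) (_≡ u i) (MD (G i) (u i)) (CG i)) where

      U : VSet J
      U = union CH CG

      MD-pendant⊆CG : ∀ {i} (a : Rest i) {t} → Outside i t → MaxDist J (inj₁ (i , a)) t → T (CG i (value a))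
      MD-pendant⊆CG {i} a out md = proj₁ (proj₂ (xvcG i)) _ (MaxDist-outward⁻ a out md)

      union-covers : ∀ x y → adj (SR J) x y → x ≢ inj₂ w → y ≢ inj₂ w → T (U x) ⊎ T (U y)
      union-covers (inj₁ (i , a)) (inj₁ (j , b)) (a≢b , a-md , b-md) _ _ with j F.≟ i
      ... | yes refl = proj₂ (proj₁ (xvcG i)) (value a) (value b)
                         ((λ eq → a≢b (cong (λ r → inj₁ (i , r)) (value-injective eq))) ,
                          MaxDist-inside⁻ a b a-md , MaxDist-inside⁻ b a b-md)
                         (Rest≢u a) (Rest≢u b)
      ... | no j≢i   = inj₁ (MD-pendant⊆CG a j≢i a-md)
      union-covers (inj₁ (_ , a)) (inj₂ _) (_ , a-md , _) _ _ = inj₁ (MD-pendant⊆CG a tt a-md)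
      union-covers (inj₂ _) (inj₁ (_ , b)) (_ , _ , b-md) _ _ = inj₂ (MD-pendant⊆CG b tt b-md)
      union-covers (inj₂ x) (inj₂ y) (x≢y , x-md , y-md) x≢w y≢w =
        proj₂ (proj₁ xvcH) x y
          ((λ x≡y → x≢y (cong inj₂ x≡y)) , Host.MaxDist-reflect x-md , Host.MaxDist-reflect y-md)
          (host-¬Excluded x-md x≢w) (host-¬Excluded y-md y≢w)

      union-IsVC : IsVC (SR J) (_≡ inj₂ w) U
      union-IsVC = (λ { _ w∈U refl → proj₁ (proj₁ xvcH) w w∈U (inj₂ refl) }) , union-covers

      union-⊇MD : ∀ x → MD J (inj₂ w) x → T (U x)
      union-⊇MD (inj₁ (_ , a)) md = MD-pendant⊆CG a tt md
      union-⊇MD (inj₂ x)       md =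
        proj₁ (proj₂ xvcH) x (Host.MaxDist-reflect md , host-¬Excluded md λ { refl → ¬MaxDist-root md })

      VJ-Σ↔ : (S : VSet J) →
              Σ VJ (T ∘ S) ↔
              (Σ (Fin k) (λ i → Σ (Rest i) λ a → T (S (inj₁ (i , a)))) ⊎ Σ (V H) (T ∘ S ∘ inj₂))
      VJ-Σ↔ S = (Σ-assoc ⊎-↔ ↔-id _) ↔-∘ Σ-distribʳ-⊎

      module _ (C′ : VSet J) (C′-IsVC : IsVC (SR J) (_≡ inj₂ w) C′)
               (MD⊆C′ : ∀ x → MD J (inj₂ w) x → T (C′ x)) where

        C′H : VSet H
        C′H = (C′ ∘ inj₂) ∖ Excluded?

        C′H-IsVC : IsVC (SR H) Excluded C′H
        C′H-IsVC = IsVC-pullback Excluded? inj₂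
          (λ { x∉ y∉ (x≢y , x-md , y-md) →
                 x≢y ∘ Host.ι-injective ,
                 MaxDist-host⁺ (¬Excluded⇒≢v x∉) x-md , MaxDist-host⁺ (¬Excluded⇒≢v y∉) y-md })
          (λ { x∉ refl → x∉ (inj₂ refl) }) C′-IsVC

        C′H-⊇MD : ∀ x → MD H w x × ¬ Excluded x → T (C′H x)
        C′H-⊇MD x (md , x∉) =
          T-∖⁺ (C′ ∘ inj₂) Excluded? x∉ (MD⊆C′ (inj₂ x) (MaxDist-host⁺ (¬Excluded⇒≢v x∉) md))

        C′G : ∀ i → VSet (G i)
        C′G i = (C′ ∘ embed i) ∖ (λ x → decG i x (u i))

        C′G-IsVC : ∀ i → IsVC (SR (G i)) (_≡ u i) (C′G i)
        C′G-IsVC i = IsVC-pullback (λ x → decG i x (u i)) (embed i)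
          (λ { x≢u y≢u (x≢y , x-md , y-md) →
                 x≢y ∘ Pendant.ι-injective i , MaxDist-inside⁺ i x≢u x-md , MaxDist-inside⁺ i y≢u y-md })
          embed-avoids-root C′-IsVC
          where
          embed-avoids-root : ∀ {x} → x ≢ u i → embed i x ≢ inj₂ w
          embed-avoids-root {x} x≢u eq with trans (sym (embed-rest i (x , [ x≢u ]))) eq
          ... | ()

        C′G-⊇MD : ∀ i x → MD (G i) (u i) x → T (C′G i x)
        C′G-⊇MD i x md = T-∖⁺ (C′ ∘ embed i) (λ y → decG i y (u i)) x≢u
          (MD⊆C′ (embed i x) (subst (λ s → MaxDist J s (inj₂ w)) (sym (embed-rest i (x , [ x≢u ])))
                                      (MaxDist-outward⁺ (x , [ x≢u ]) tt md)))
          where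
          x≢u : x ≢ u i
          x≢u refl = ¬MaxDist-u i md

        C′G-↣ : ∀ i → Σ (V (G i)) (T ∘ C′G i) ↣ Σ (Rest i) (λ a → T (C′ (inj₁ (i , a))))
        C′G-↣ i = mk↣ {to = to} λ eq → Σ-T-≡ (cong (value ∘ proj₁) eq)
          where
          to : Σ (V (G i)) (T ∘ C′G i) → Σ (Rest i) (λ a → T (C′ (inj₁ (i , a))))
          to (x , x∈) = let (x≢u , x∈C′) = T-∖⁻ (C′ ∘ embed i) (λ y → decG i y (u i)) x∈ in
            (x , [ x≢u ]) , subst (T ∘ C′) (embed-rest i (x , [ x≢u ])) x∈C′

        pendant-↣ : ∀ i → Σ (Rest i) (T ∘ CG i ∘ value) ↣ Σ (Rest i) (λ a → T (C′ (inj₁ (i , a))))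
        pendant-↣ i =
          C′G-↣ i ↣-∘ (IsXVC⇒↣ (finiteG i) (xvcG i) (C′G-IsVC i) (C′G-⊇MD i) ↣-∘ value-↣ (CG i))

        host-↣ : Σ (V H) (T ∘ CH) ↣ Σ (V H) (T ∘ C′ ∘ inj₂)
        host-↣ = ∖-↣ (C′ ∘ inj₂) Excluded? ↣-∘ IsXVC⇒↣ finiteH xvcH C′H-IsVC C′H-⊇MD

        union-↣ : Σ VJ (T ∘ U) ↣ Σ VJ (T ∘ C′)
        union-↣ = ↔⇒↣ (↔-sym (VJ-Σ↔ C′)) ↣-∘
                  (((Σ-↣ (↔-id _) λ {i} → pendant-↣ i) ⊎-↣ host-↣) ↣-∘ ↔⇒↣ (VJ-Σ↔ U))

lemma9 : (k : ℕ) → 1 ≤ k →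
    (G : Fin k → Graph) → (H : Graph) →
    (∀ i → Finite (G i) × Simple (G i) × Connected (G i) × AtLeastTwo (G i)) →
    Finite H → Simple H → Connected H → AtLeastTwo H →
    (u : (i : Fin k) → V (G i)) → (v : Fin k → V H) → (w : V H) →
    (CH : VSet H) → (CG : (i : Fin k) → VSet (G i)) →
    IsXVC (SR H) (λ x → (∃ λ i → x ≡ v i) ⊎ x ≡ w)
      (λ x → MD H w x × ¬ ((∃ λ i → x ≡ v i) ⊎ x ≡ w)) CH →
    (∀ i → IsXVC (SR (G i)) (λ x → x ≡ u i) (MD (G i) (u i)) (CG i)) →
    IsXVC (SR (Compose.J G H u v)) (λ x → x ≡ inj₂ w)
      (MD (Compose.J G H u v) (inj₂ w)) (Compose.union G H u v CH CG)
lemma9 k _ G H hG finiteH simpleH connectedH nontrivialH u v w CH CG xvcH xvcG =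
  union-IsVC CH CG xvcH xvcG ,
  union-⊇MD CH CG xvcH xvcG ,
  λ C′ C′-IsVC MD⊆C′ _ _ U↔n C′↔n′ →
    ↣⇒≤ (union-↣ CH CG xvcH xvcG C′ C′-IsVC MD⊆C′) U↔n C′↔n′
  where
  open Composition G H hG finiteH simpleH connectedH nontrivialH u v
  open Cover w
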